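{- Let $a=(a_1,\dots,a_n)$ be a sequence of positive integers, let $I$ be a subset of $\{1,2,\dots,n\}$ with at least two elements, and let $r$ be an integer such that none of the denominators below vanishes (i.e. the exponents $|a|-a_i+r$, $|a|-a_i-a_J+r$, $|a|-a_J+r$ occurring are non-zero). Then, as an identity of rational functions in $q$, \[ \sum_{i\in I}\ \sum_{\emptyset\neq J\subseteq I\setminus\{i\}}(-1)^{|J|+1}\,q^{\sum_{j=i+1}^n a_j+L_{I\setminus\{i\},J}(a^{(i)})}\, \frac{(1-q^{a_i})(1-q^{a_J})}{(1-q^{|a|-a_i+r})(1-q^{|a|-a_i-a_J+r})} =\sum_{\emptyset\neq J\subseteq I}(-1)^{|J|}\,q^{L_{I,J}(a)}\,\frac{1-q^{a_J}}{1-q^{|a|-a_J+r}}. \]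
   Context: $q$ is an indeterminate; $|a|=a_1+\dots+a_n$, $|J|$ is the number of elements of $J$, and $a_S:=\sum_{j\in S}a_j$. For $I,J\subseteq\{1,\dots,n\}$, $L_{I,J}(a):=\sum_{1\le u\le v\le n,\ u\in I,\ v\notin J} a_v$. The sequence $a^{(i)}$ is $a$ with the entry $a_i$ deleted, its entries keeping their original indices in $\{1,\dots,n\}\setminus\{i\}$; accordingly, for $I',J'\subseteq\{1,\dots,n\}\setminus\{i\}$, $L_{I',J'}(a^{(i)}):=\sum a_v$ over pairs $u\le v$ with $u,v\ne i$, $u\in I'$, $v\notin J'$. -}

module Defs where

open import Data.Bool using (Bool; true; false; if_then_else_)
open import Data.Nat as ℕ using (ℕ; zero; suc)
open import Data.Integer as ℤ using (ℤ; +_; -[1+_])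
open import Data.Fin using (Fin; toℕ) renaming (zero to fzero; suc to fsuc)
open import Data.Fin.Subset using (Subset; _∈_; _∉_; _⊆_; Nonempty; ∣_∣; _-_; inside; outside)
open import Data.Fin.Subset.Properties using (_∈?_; _⊆?_; nonempty?)
open import Data.Vec using (Vec; []; _∷_)
open import Data.List using (List; []; _∷_; map; _++_; foldr)
open import Data.Rational using (ℚ; mkℚ; 0ℚ; 1ℚ; _+_; _*_; -_; 1/_)
open import Relation.Nullary using (Dec; yes; no; does; ¬_)
open import Data.Product using (_×_)
open import Relation.Binary.PropositionalEquality using (_≡_; _≢_)

allSubsets : (n : ℕ) → List (Subset n)
allSubsets zero = [] ∷ []
allSubsets (suc n) = map (outside ∷_) (allSubsets n) ++ map (inside ∷_) (allSubsets n)

allFins : (n : ℕ) → List (Fin n)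
allFins zero = []
allFins (suc n) = fzero ∷ map fsuc (allFins n)

sumℚ : List ℚ → ℚ
sumℚ = foldr _+_ 0ℚ

sumℕ : List ℕ → ℕ
sumℕ = foldr ℕ._+_ 0

sumℕ-if : {A : Set} {P : A → Set} → ((x : A) → Dec (P x)) → (A → ℕ) → List A → ℕ
sumℕ-if P? f xs = sumℕ (map (λ x → if does (P? x) then f x else 0) xs)

sumℚ-if : {A : Set} {P : A → Set} → ((x : A) → Dec (P x)) → (A → ℚ) → List A → ℚ
sumℚ-if P? f xs = sumℚ (map (λ x → if does (P? x) then f x else 0ℚ) xs)

total : {n : ℕ} → (Fin n → ℕ) → ℕ
total {n} a = sumℕ (map a (allFins n))

aS : {n : ℕ} → (Fin n → ℕ) → Subset n → ℕ
aS {n} a S = sumℕ-if (_∈? S) a (allFins n)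

tailSum : {n : ℕ} → (Fin n → ℕ) → Fin n → ℕ
tailSum {n} a i = sumℕ-if (λ j → toℕ i ℕ.<? toℕ j) a (allFins n)

_×?_ : {P Q : Set} → Dec P → Dec Q → Dec (P × Q)
yes p ×? yes q = yes (p Data.Product., q)
yes p ×? no ¬q = no (λ pq → ¬q (Data.Product.proj₂ pq))
no ¬p ×? _ = no (λ pq → ¬p (Data.Product.proj₁ pq))

¬? : {P : Set} → Dec P → Dec (¬ P)
¬? (yes p) = no (λ np → np p)
¬? (no np) = yes np

L : {n : ℕ} → (Fin n → ℕ) → Subset n → Subset n → ℕ
L {n} a I J =
  sumℕ (map (λ u → sumℕ-if (λ v → (toℕ u ℕ.≤? toℕ v) ×? ((u ∈? I) ×? ¬? (v ∈? J)))
                           a (allFins n))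
            (allFins n))

-- L_{I',J'}(a^{(i)}) = Σ a_v over u ≤ v with u ≠ i, v ≠ i, u ∈ I', v ∉ J'
-- (a^{(i)} keeps the original indices, so we sum over Fin n avoiding i)
Ldel : {n : ℕ} → (Fin n → ℕ) → Fin n → Subset n → Subset n → ℕ
Ldel {n} a i I J =
  sumℕ (map (λ u → sumℕ-if (λ v → (toℕ u ℕ.≤? toℕ v) ×?
                                    ((¬? (u Data.Fin.≟ i) ×? ¬? (v Data.Fin.≟ i)) ×?
                                     ((u ∈? I) ×? ¬? (v ∈? J))))
                           a (allFins n))
            (allFins n))

-- multiplicative inverse on ℚ, made total by 1/0 := 0 (only used at nonzero arguments)
inv : ℚ → ℚ
inv (mkℚ (+ zero) _ _) = 0ℚ
inv p@(mkℚ (+ suc _) _ _) = 1/ p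
inv p@(mkℚ -[1+ _ ] _ _) = 1/ p

_÷'_ : ℚ → ℚ → ℚ
x ÷' y = x * inv y

_^ℕ_ : ℚ → ℕ → ℚ
x ^ℕ zero = 1ℚ
x ^ℕ suc k = x * (x ^ℕ k)

-- integer powers in ℚ (q^{-k} = 1 / q^k); used only for q ≠ 0
_^ℤ_ : ℚ → ℤ → ℚ
x ^ℤ (+ k) = x ^ℕ k
x ^ℤ -[1+ k ] = inv (x ^ℕ suc k)

-1ℚ : ℚ
-1ℚ = - 1ℚ

oneMinus : ℚ → ℤ → ℚ
oneMinus q m = 1ℚ + (- (q ^ℤ m))

nonemptySub? : {n : ℕ} (S J : Subset n) → Dec (Nonempty J × J ⊆ S)
nonemptySub? S J = nonempty? J ×? (J ⊆? S)

expA : {n : ℕ} → (Fin n → ℕ) → ℤ → Fin n → ℤ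
expA a r i = (+ total a ℤ.- + a i) ℤ.+ r

expB : {n : ℕ} → (Fin n → ℕ) → ℤ → Fin n → Subset n → ℤ
expB a r i J = ((+ total a ℤ.- + a i) ℤ.- + aS a J) ℤ.+ r

expC : {n : ℕ} → (Fin n → ℕ) → ℤ → Subset n → ℤ
expC a r J = (+ total a ℤ.- + aS a J) ℤ.+ r

LHS : {n : ℕ} → (Fin n → ℕ) → Subset n → ℤ → ℚ → ℚ
LHS {n} a I r q =
  sumℚ-if (_∈? I)
    (λ i → sumℚ-if (nonemptySub? (I - i))
      (λ J → (-1ℚ ^ℕ (∣ J ∣ ℕ.+ 1)) *
             ((q ^ℕ (tailSum a i ℕ.+ Ldel a i (I - i) J)) *
              ((oneMinus q (+ a i) * oneMinus q (+ aS a J)) ÷'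
               (oneMinus q (expA a r i) * oneMinus q (expB a r i J)))))
      (allSubsets n))
    (allFins n)

RHS : {n : ℕ} → (Fin n → ℕ) → Subset n → ℤ → ℚ → ℚ
RHS {n} a I r q =
  sumℚ-if (nonemptySub? I)
    (λ J → (-1ℚ ^ℕ ∣ J ∣) * ((q ^ℕ L a I J) * (oneMinus q (+ aS a J) ÷' oneMinus q (expC a r J))))
    (allSubsets n)

-- Fix i ∈ I and write A = |a| - a_i + r, B = A - a_J.  Each left-hand summand
-- splits into partial fractions, (1 - q^{a_J}) / ((1 - q^A)(1 - q^B)) =
-- 1/(1 - q^B) - q^{a_J}/(1 - q^A).  Over all J ⊆ I - i (∅ included) the second
-- fractions cancel in pairs by toggling the least element of I - i, which exists since
-- |I| ≥ 2; at J = ∅ both fractions agree.  So the inner sum is the sum of the first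
-- fractions over all J ⊆ I - i.  Reindexing by K = J ∪ {i} and exchanging the order of
-- summation, for each K ⊆ I the sum over i ∈ K telescopes to the right-hand summand of K
-- (the exponents match by an identity between L_{I,K}(a) and L_{I-i,K-i}(a^{(i)})), and
-- K = ∅ contributes nothing.
module Submission where

open import Algebra.Structures using (IsCommutativeMonoid)
open import Data.Fin using (Fin)
open import Data.Fin.Subset using (Subset)
open import Data.Integer using (ℤ)
open import Data.Nat using (ℕ)
open import Data.Rational using (ℚ)
open import Relation.Binary.PropositionalEquality

module DecisionsAndSubsets where

  open import Data.Bool using (Bool; true; false; if_then_else_; _∧_; not)
  open import Data.Empty using (⊥-elim)
  open import Data.Fin using (Fin; toℕ; _≟_) renaming (zero to fzero; suc to fsuc)
  open import Data.Fin.Subset using (Subset; inside; outside; _∈_; _⊆_; Nonempty; ∣_∣; _-_; ⁅_⁆; ⊥)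
  open import Data.Fin.Subset.Properties
    using (_∈?_; _⊆?_; nonempty?; p─⊥≡p; Empty-unique; ∉⊥; ⊥⊆; x∈⁅x⁆; p⊆q⇒∣p∣≤∣q∣; ∣⁅x⁆∣≡1; x∈p∧x≢y⇒x∈p-y; p─q⊆p)
  open import Data.Nat as ℕ using (suc; z≤n; s≤s)
  import Data.Nat.Properties as ℕ
  open import Data.Product using (_×_; _,_; ∃-syntax)
  open import Data.Vec using (_∷_; lookup; _[_]≔_; here; there)
  open import Data.Vec.Properties using ([]=⇒lookup; lookup⇒[]=; lookup∘update′)
  open import Function.Bundles using (mk⇔)
  open import Relation.Nullary using (Dec; yes; no; does)
  open import Relation.Nullary.Decidable using (dec-true; dec-false; does-⇔)
  open import Defs using (_×?_; ¬?; nonemptySub?)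

  does-×? : {P Q : Set} (p : Dec P) (q : Dec Q) → does (p ×? q) ≡ (does p ∧ does q)
  does-×? (yes _) (yes _) = refl
  does-×? (yes _) (no _) = refl
  does-×? (no _) _ = refl

  does-¬? : {P : Set} (p : Dec P) → does (¬? p) ≡ not (does p)
  does-¬? (yes _) = refl
  does-¬? (no _) = refl

  does-∈? : ∀ {n} (x : Fin n) (p : Subset n) → does (x ∈? p) ≡ lookup p x
  does-∈? fzero (true ∷ p) = refl
  does-∈? fzero (false ∷ p) = refl
  does-∈? (fsuc x) (b ∷ p) = does-∈? x p

  if-cong : ∀ {A : Set} {b c : Bool} (x y : A) → b ≡ c → (if b then x else y) ≡ (if c then x else y)
  if-cong x y refl = refl

  true≢false : true ≢ false
  true≢false ()

  insert : ∀ {n} → Fin n → Subset n → Subset n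
  insert i J = J [ i ]≔ inside

  lookup-delete-same : ∀ {n} (p : Subset n) y → lookup (p - y) y ≡ false
  lookup-delete-same (b ∷ p) fzero = refl
  lookup-delete-same (b ∷ p) (fsuc y) = lookup-delete-same p y

  lookup-delete-other : ∀ {n} (p : Subset n) {x y : Fin n} → x ≢ y → lookup (p - y) x ≡ lookup p x
  lookup-delete-other (b ∷ p) {fzero} {fzero} x≢y = ⊥-elim (x≢y refl)
  lookup-delete-other (b ∷ p) {fsuc x} {fzero} x≢y = cong (λ z → lookup z x) (p─⊥≡p p)
  lookup-delete-other (b ∷ p) {fzero} {fsuc y} x≢y = refl
  lookup-delete-other (b ∷ p) {fsuc x} {fsuc y} x≢y = lookup-delete-other p (x≢y ∘′ cong fsuc)
    where open import Function using (_∘′_)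

  ∣insert∣ : ∀ {n} (J : Subset n) i → lookup J i ≡ false → ∣ insert i J ∣ ≡ suc ∣ J ∣
  ∣insert∣ (false ∷ J) fzero i∉J = refl
  ∣insert∣ (true ∷ J) (fsuc i) i∉J = cong suc (∣insert∣ J i i∉J)
  ∣insert∣ (false ∷ J) (fsuc i) i∉J = ∣insert∣ J i i∉J

  insert-delete : ∀ {n} (J : Subset n) i → lookup J i ≡ false → insert i J - i ≡ J
  insert-delete (false ∷ J) fzero i∉J = cong (outside ∷_) (p─⊥≡p J)
  insert-delete (b ∷ J) (fsuc i) i∉J = cong (b ∷_) (insert-delete J i i∉J)

  minimum : ∀ {n} (p : Subset n) → Nonempty p → ∃[ j ] (j ∈ p × (∀ u → u ∈ p → toℕ j ℕ.≤ toℕ u))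
  minimum (true ∷ p) _ = fzero , here , λ u _ → z≤n
  minimum (false ∷ p) (fsuc x , there x∈p) with minimum p (x , x∈p)
  ... | j , j∈p , least = fsuc j , there j∈p , λ { (fsuc u) (there u∈p) → s≤s (least u u∈p) }

  delete-nonempty : ∀ {n} (I : Subset n) i → 2 ℕ.≤ ∣ I ∣ → Nonempty (I - i)
  delete-nonempty I i 2≤∣I∣ with nonempty? (I - i)
  ... | yes ne = ne
  ... | no empty = ⊥-elim (ℕ.<-irrefl refl
        (ℕ.≤-trans 2≤∣I∣ (ℕ.≤-trans (p⊆q⇒∣p∣≤∣q∣ I⊆⁅i⁆) (ℕ.≤-reflexive (∣⁅x⁆∣≡1 i)))))
    where
    I⊆⁅i⁆ : I ⊆ ⁅ i ⁆
    I⊆⁅i⁆ {x} x∈I with x ≟ i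
    ... | yes refl = x∈⁅x⁆ i
    ... | no x≢i = ⊥-elim (empty (x , x∈p∧x≢y⇒x∈p-y x∈I x≢i))

  ∈insert⇒∈ : ∀ {n} {x i : Fin n} J → x ≢ i → x ∈ insert i J → x ∈ J
  ∈insert⇒∈ {x = x} J x≢i x∈iJ = lookup⇒[]= x J (trans (sym (lookup∘update′ x≢i J inside)) ([]=⇒lookup x∈iJ))

  ∈⇒∈insert : ∀ {n} {x i : Fin n} J → x ≢ i → x ∈ J → x ∈ insert i J
  ∈⇒∈insert {x = x} J x≢i x∈J = lookup⇒[]= x _ (trans (lookup∘update′ x≢i J inside) ([]=⇒lookup x∈J))

  insert⊆⇔⊆delete : ∀ {n} (i : Fin n) (I J : Subset n) → lookup I i ≡ true → lookup J i ≡ false →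
                    does (insert i J ⊆? I) ≡ does (J ⊆? (I - i))
  insert⊆⇔⊆delete i I J i∈I i∉J = does-⇔ (mk⇔ to from) (insert i J ⊆? I) (J ⊆? (I - i))
    where
    to : insert i J ⊆ I → J ⊆ (I - i)
    to sub {x} x∈J with x ≟ i
    ... | yes refl = ⊥-elim (true≢false (trans (sym ([]=⇒lookup x∈J)) i∉J))
    ... | no x≢i = x∈p∧x≢y⇒x∈p-y (sub (∈⇒∈insert J x≢i x∈J)) x≢i
    from : J ⊆ (I - i) → insert i J ⊆ I
    from sub {x} x∈iJ with x ≟ i
    ... | yes refl = lookup⇒[]= x I i∈I
    ... | no x≢i = p─q⊆p I ⁅ i ⁆ (sub (∈insert⇒∈ J x≢i x∈iJ))

  insert⊆⇔⊆ : ∀ {n} (j : Fin n) (S J : Subset n) → lookup S j ≡ true →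
              does (insert j J ⊆? S) ≡ does (J ⊆? S)
  insert⊆⇔⊆ j S J j∈S = does-⇔ (mk⇔ to from) (insert j J ⊆? S) (J ⊆? S)
    where
    to : insert j J ⊆ S → J ⊆ S
    to sub {x} x∈J with x ≟ j
    ... | yes refl = lookup⇒[]= x S j∈S
    ... | no x≢j = sub (∈⇒∈insert J x≢j x∈J)
    from : J ⊆ S → insert j J ⊆ S
    from sub {x} x∈jJ with x ≟ j
    ... | yes refl = lookup⇒[]= x S j∈S
    ... | no x≢j = sub (∈insert⇒∈ J x≢j x∈jJ)

  ∈⇒⊈delete : ∀ {n} (i : Fin n) (I J : Subset n) → lookup J i ≡ true → does (J ⊆? (I - i)) ≡ false
  ∈⇒⊈delete i I J i∈J = dec-false (J ⊆? (I - i))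
    (λ sub → true≢false (trans (sym ([]=⇒lookup (sub (lookup⇒[]= i J i∈J)))) (lookup-delete-same I i)))

  nonemptySub-∅ : ∀ {n} (S : Subset n) → does (nonemptySub? S (⊥ {n})) ≡ false
  nonemptySub-∅ {n} S = trans (does-×? (nonempty? ∅) (∅ ⊆? S))
                              (cong (_∧ does (∅ ⊆? S)) (dec-false (nonempty? ∅) λ { (x , x∈∅) → ∉⊥ x∈∅ }))
    where ∅ = ⊥ {n}

  nonemptySub-≢∅ : ∀ {n} (S J : Subset n) → J ≢ ⊥ {n} → does (nonemptySub? S J) ≡ does (J ⊆? S)
  nonemptySub-≢∅ S J J≢∅ = trans (does-×? (nonempty? J) (J ⊆? S))
                                 (cong (_∧ does (J ⊆? S)) (dec-true (nonempty? J) nonempty))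
    where
    nonempty : Nonempty J
    nonempty with nonempty? J
    ... | yes ne = ne
    ... | no empty = ⊥-elim (J≢∅ (Empty-unique empty))

  ∅⊆? : ∀ {n} (S : Subset n) → does (⊥ {n} ⊆? S) ≡ true
  ∅⊆? {n} S = dec-true (⊥ {n} ⊆? S) ⊥⊆

module FiniteSums {A : Set} {_⊕_ : A → A → A} {ε : A}
                  (isCM : IsCommutativeMonoid _≡_ _⊕_ ε) where

  open import Algebra.Bundles using (CommutativeMonoid)
  open import Data.Fin using (Fin; punchIn) renaming (zero to fzero; suc to fsuc)
  open import Data.Fin.Properties using (punchInᵢ≢i)
  open import Data.Fin.Subset using (Subset; inside; outside; ⊥)
  open import Data.Fin.Subset.Properties using (_⊆?_)
  open import Relation.Nullary using (does)
  open import Data.List using (List; []; _∷_; map; _++_; foldr)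
  import Data.List.Properties as List
  open import Data.Nat using (zero; suc)
  open import Data.Bool using (if_then_else_)
  open import Data.Vec using ([]; _∷_; lookup)
  open import Data.Vec.Properties using (∷-injectiveʳ)
  open import Function using (_∘_)
  open import Level using (0ℓ)
  open import Defs using (allFins; allSubsets; nonemptySub?)
  open DecisionsAndSubsets

  commutativeMonoid : CommutativeMonoid 0ℓ 0ℓ
  commutativeMonoid = record
    { Carrier = A ; _≈_ = _≡_ ; _∙_ = _⊕_ ; ε = ε ; isCommutativeMonoid = isCM }

  open IsCommutativeMonoid isCM using (assoc; comm; identityˡ; identityʳ)
  open import Algebra.Properties.CommutativeSemigroup
    (CommutativeMonoid.commutativeSemigroup commutativeMonoid)
    using (interchange; xy∙z≈zy∙x; xy∙z≈xz∙y)
  open import Algebra.Properties.CommutativeMonoid.Sum commutativeMonoid public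
    using (sum; sum-cong-≗; ∑-distrib-+; sum-replicate-zero)
  open import Algebra.Properties.CommutativeMonoid.Sum commutativeMonoid
    using (sum-remove)
  open ≡-Reasoning

  fold : List A → A
  fold = foldr _⊕_ ε

  fold-++ : ∀ xs ys → fold (xs ++ ys) ≡ fold xs ⊕ fold ys
  fold-++ [] ys = sym (identityˡ _)
  fold-++ (x ∷ xs) ys = trans (cong (x ⊕_) (fold-++ xs ys)) (sym (assoc _ _ _))

  fold-allFins : ∀ n (f : Fin n → A) → fold (map f (allFins n)) ≡ sum f
  fold-allFins zero f = refl
  fold-allFins (suc n) f = cong (f fzero ⊕_)
    (trans (cong fold (sym (List.map-∘ (allFins n)))) (fold-allFins n (f ∘ fsuc)))

  sum-exchange : ∀ {n} (j : Fin n) (f g : Fin n → A) → (∀ x → x ≢ j → f x ≡ g x) →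
                 sum f ⊕ g j ≡ sum g ⊕ f j
  sum-exchange {suc n} j f g agree = begin
    sum f ⊕ g j                   ≡⟨ cong (_⊕ g j) (sum-remove f) ⟩
    (f j ⊕ rest f) ⊕ g j          ≡⟨ cong (λ z → (f j ⊕ z) ⊕ g j) (sum-cong-≗ offj) ⟩
    (f j ⊕ rest g) ⊕ g j          ≡⟨ xy∙z≈zy∙x (f j) (rest g) (g j) ⟩
    (g j ⊕ rest g) ⊕ f j          ≡⟨ cong (_⊕ f j) (sum-remove g) ⟨
    sum g ⊕ f j                   ∎
    where
    rest : (Fin (suc n) → A) → A
    rest h = sum (h ∘ punchIn j)
    offj : ∀ x → f (punchIn j x) ≡ g (punchIn j x)
    offj x = agree (punchIn j x) (punchInᵢ≢i j x)

  sum-single : ∀ {n} (j : Fin n) (f : Fin n → A) → (∀ x → x ≢ j → f x ≡ ε) → sum f ≡ f j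
  sum-single {n} j f vanish = begin
    sum f                    ≡⟨ identityʳ _ ⟨
    sum f ⊕ ε                ≡⟨ sum-exchange j f (λ _ → ε) vanish ⟩
    sum {n} (λ _ → ε) ⊕ f j  ≡⟨ cong (_⊕ f j) (sum-replicate-zero n) ⟩
    ε ⊕ f j                  ≡⟨ identityˡ _ ⟩
    f j                      ∎

  ΣS : ∀ n → (Subset n → A) → A
  ΣS zero f = f []
  ΣS (suc n) f = ΣS n (λ K → f (outside ∷ K)) ⊕ ΣS n (λ K → f (inside ∷ K))

  fold-allSubsets : ∀ n (f : Subset n → A) → fold (map f (allSubsets n)) ≡ ΣS n f
  fold-allSubsets zero f = identityʳ _
  fold-allSubsets (suc n) f = begin
    fold (map f (outs ++ ins))              ≡⟨ cong fold (List.map-++ f outs ins) ⟩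
    fold (map f outs ++ map f ins)          ≡⟨ fold-++ (map f outs) (map f ins) ⟩
    fold (map f outs) ⊕ fold (map f ins)    ≡⟨ cong₂ _⊕_ (half outside) (half inside) ⟩
    ΣS (suc n) f                            ∎
    where
    outs = map (outside ∷_) (allSubsets n)
    ins = map (inside ∷_) (allSubsets n)
    half : ∀ b → fold (map f (map (b ∷_) (allSubsets n))) ≡ ΣS n (λ K → f (b ∷ K))
    half b = trans (cong fold (sym (List.map-∘ (allSubsets n)))) (fold-allSubsets n _)

  ΣS-cong : ∀ n {f g : Subset n → A} → (∀ K → f K ≡ g K) → ΣS n f ≡ ΣS n g
  ΣS-cong zero eq = eq []
  ΣS-cong (suc n) eq = cong₂ _⊕_ (ΣS-cong n (eq ∘ (outside ∷_))) (ΣS-cong n (eq ∘ (inside ∷_)))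

  ΣS-⊕ : ∀ n (f g : Subset n → A) → ΣS n (λ K → f K ⊕ g K) ≡ ΣS n f ⊕ ΣS n g
  ΣS-⊕ zero f g = refl
  ΣS-⊕ (suc n) f g = trans (cong₂ _⊕_ (ΣS-⊕ n _ _) (ΣS-⊕ n _ _)) (interchange _ _ _ _)

  ΣS-zero : ∀ n → ΣS n (λ _ → ε) ≡ ε
  ΣS-zero zero = refl
  ΣS-zero (suc n) = trans (cong₂ _⊕_ (ΣS-zero n) (ΣS-zero n)) (identityˡ ε)

  ΣS-hom : ∀ n (h : A → A) → h ε ≡ ε → (∀ x y → h (x ⊕ y) ≡ h x ⊕ h y) →
           (f : Subset n → A) → ΣS n (h ∘ f) ≡ h (ΣS n f)
  ΣS-hom zero h h-ε h-⊕ f = refl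
  ΣS-hom (suc n) h h-ε h-⊕ f =
    trans (cong₂ _⊕_ (ΣS-hom n h h-ε h-⊕ _) (ΣS-hom n h h-ε h-⊕ _)) (sym (h-⊕ _ _))

  sum-ΣS-comm : ∀ n m (f : Fin n → Subset m → A) →
                sum (λ i → ΣS m (f i)) ≡ ΣS m (λ K → sum (λ i → f i K))
  sum-ΣS-comm zero m f = sym (ΣS-zero m)
  sum-ΣS-comm (suc n) m f =
    trans (cong (ΣS m (f fzero) ⊕_) (sum-ΣS-comm n m (f ∘ fsuc))) (sym (ΣS-⊕ m _ _))

  ΣS-exchange : ∀ n (K₀ : Subset n) (f g : Subset n → A) → (∀ K → K ≢ K₀ → f K ≡ g K) →
                ΣS n f ⊕ g K₀ ≡ ΣS n g ⊕ f K₀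
  ΣS-exchange zero [] f g agree = comm (f []) (g [])
  ΣS-exchange (suc n) (outside ∷ K₀) f g agree = begin
    (ΣS n (f ∘ (outside ∷_)) ⊕ ΣS n (f ∘ (inside ∷_))) ⊕ g (outside ∷ K₀)
      ≡⟨ cong (λ z → (ΣS n (f ∘ (outside ∷_)) ⊕ z) ⊕ g (outside ∷ K₀)) (ΣS-cong n (λ K → agree (inside ∷ K) λ ())) ⟩
    (ΣS n (f ∘ (outside ∷_)) ⊕ ΣS n (g ∘ (inside ∷_))) ⊕ g (outside ∷ K₀)
      ≡⟨ xy∙z≈xz∙y _ _ _ ⟩
    (ΣS n (f ∘ (outside ∷_)) ⊕ g (outside ∷ K₀)) ⊕ ΣS n (g ∘ (inside ∷_))
      ≡⟨ cong (_⊕ ΣS n (g ∘ (inside ∷_))) (ΣS-exchange n K₀ _ _ λ K K≢K₀ → agree (outside ∷ K) (K≢K₀ ∘ ∷-injectiveʳ)) ⟩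
    (ΣS n (g ∘ (outside ∷_)) ⊕ f (outside ∷ K₀)) ⊕ ΣS n (g ∘ (inside ∷_))
      ≡⟨ xy∙z≈xz∙y _ _ _ ⟩
    (ΣS n (g ∘ (outside ∷_)) ⊕ ΣS n (g ∘ (inside ∷_))) ⊕ f (outside ∷ K₀) ∎
  ΣS-exchange (suc n) (inside ∷ K₀) f g agree = begin
    (ΣS n (f ∘ (outside ∷_)) ⊕ ΣS n (f ∘ (inside ∷_))) ⊕ g (inside ∷ K₀)
      ≡⟨ assoc _ _ _ ⟩
    ΣS n (f ∘ (outside ∷_)) ⊕ (ΣS n (f ∘ (inside ∷_)) ⊕ g (inside ∷ K₀))
      ≡⟨ cong₂ _⊕_ (ΣS-cong n (λ K → agree (outside ∷ K) λ ()))
                   (ΣS-exchange n K₀ _ _ λ K K≢K₀ → agree (inside ∷ K) (K≢K₀ ∘ ∷-injectiveʳ)) ⟩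
    ΣS n (g ∘ (outside ∷_)) ⊕ (ΣS n (g ∘ (inside ∷_)) ⊕ f (inside ∷ K₀))
      ≡⟨ assoc _ _ _ ⟨
    (ΣS n (g ∘ (outside ∷_)) ⊕ ΣS n (g ∘ (inside ∷_))) ⊕ f (inside ∷ K₀) ∎

  -- Inserting i is a bijection from subsets avoiding i onto subsets containing i.
  ΣS-insert : ∀ n (i : Fin n) (f : Subset n → A) →
              ΣS n (λ K → if lookup K i then f K else ε) ≡
              ΣS n (λ J → if lookup J i then ε else f (insert i J))
  ΣS-insert (suc n) fzero f = begin
    ΣS n (λ _ → ε) ⊕ ΣS n (f ∘ (inside ∷_))  ≡⟨ cong (_⊕ ΣS n (f ∘ (inside ∷_))) (ΣS-zero n) ⟩
    ε ⊕ ΣS n (f ∘ (inside ∷_))               ≡⟨ identityˡ _ ⟩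
    ΣS n (f ∘ (inside ∷_))                   ≡⟨ identityʳ _ ⟨
    ΣS n (f ∘ (inside ∷_)) ⊕ ε               ≡⟨ cong (ΣS n (f ∘ (inside ∷_)) ⊕_) (ΣS-zero n) ⟨
    ΣS n (f ∘ (inside ∷_)) ⊕ ΣS n (λ _ → ε)  ∎
  ΣS-insert (suc n) (fsuc i) f =
    cong₂ _⊕_ (ΣS-insert n i (f ∘ (outside ∷_))) (ΣS-insert n i (f ∘ (inside ∷_)))

  ΣS-adjoin-∅ : ∀ n (S : Subset n) (f : Subset n → A) →
    ΣS n (λ J → if does (nonemptySub? S J) then f J else ε) ⊕ f ⊥ ≡
    ΣS n (λ J → if does (J ⊆? S) then f J else ε)
  ΣS-adjoin-∅ n S f = begin
    ΣS n nonempty ⊕ f ⊥       ≡⟨ cong (ΣS n nonempty ⊕_) (if-cong (f ⊥) ε (∅⊆? S)) ⟨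
    ΣS n nonempty ⊕ all ⊥     ≡⟨ ΣS-exchange n ⊥ nonempty all agree ⟩
    ΣS n all ⊕ nonempty ⊥     ≡⟨ cong (ΣS n all ⊕_) (if-cong (f ⊥) ε (nonemptySub-∅ S)) ⟩
    ΣS n all ⊕ ε              ≡⟨ identityʳ _ ⟩
    ΣS n all                  ∎
    where
    nonempty all : Subset n → A
    nonempty J = if does (nonemptySub? S J) then f J else ε
    all J = if does (J ⊆? S) then f J else ε
    agree : ∀ J → J ≢ ⊥ → nonempty J ≡ all J
    agree J J≢∅ = if-cong (f J) ε (nonemptySub-≢∅ S J J≢∅)

module RationalArithmetic where

  open import Data.Empty using (⊥-elim)
  open import Data.Integer as ℤ using (+_; -[1+_]; 0ℤ)
  import Data.Integer.Properties as ℤ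
  open import Data.Maybe using (Maybe; just; nothing)
  open import Data.Nat as ℕ using (zero; suc)
  open import Data.Rational using (ℚ; mkℚ; 0ℚ; 1ℚ; _+_; _*_; -_; _<_; Positive; positive; negative; *≡*)
  import Data.Rational.Properties as ℚ
  open import Relation.Binary.Definitions using (tri<; tri≈; tri>)
  open import Relation.Nullary using (yes; no)
  open import Tactic.RingSolver using (solve-∀)
  open import Tactic.RingSolver.Core.AlmostCommutativeRing using (AlmostCommutativeRing; fromCommutativeRing)
  open import Defs using (inv; _^ℕ_; _^ℤ_; -1ℚ; oneMinus)

  ℚ-ring : AlmostCommutativeRing _ _
  ℚ-ring = fromCommutativeRing ℚ.+-*-commutativeRing isZero
    where
    isZero : ∀ x → Maybe (0ℚ ≡ x)
    isZero x with 0ℚ ℚ.≟ x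
    ... | yes 0≡x = just 0≡x
    ... | no _ = nothing

  1≢0 : 1ℚ ≢ 0ℚ
  1≢0 ()

  inv-inverseʳ : ∀ x → x ≢ 0ℚ → x * inv x ≡ 1ℚ
  inv-inverseʳ (mkℚ (+ zero) _ _) x≢0 = ⊥-elim (x≢0 (ℚ.≃⇒≡ (*≡* refl)))
  inv-inverseʳ p@(mkℚ (+ suc _) _ _) _ = ℚ.*-inverseʳ p
  inv-inverseʳ p@(mkℚ -[1+ _ ] _ _) _ = ℚ.*-inverseʳ p

  inv-inverseˡ : ∀ x → x ≢ 0ℚ → inv x * x ≡ 1ℚ
  inv-inverseˡ x x≢0 = trans (ℚ.*-comm (inv x) x) (inv-inverseʳ x x≢0)

  zero-product : ∀ x y → x ≢ 0ℚ → x * y ≡ 0ℚ → y ≡ 0ℚ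
  zero-product x y x≢0 xy≡0 = begin
    y                ≡⟨ ℚ.*-identityˡ y ⟨
    1ℚ * y           ≡⟨ cong (_* y) (inv-inverseˡ x x≢0) ⟨
    (inv x * x) * y  ≡⟨ ℚ.*-assoc (inv x) x y ⟩
    inv x * (x * y)  ≡⟨ cong (inv x *_) xy≡0 ⟩
    inv x * 0ℚ       ≡⟨ ℚ.*-zeroʳ (inv x) ⟩
    0ℚ               ∎
    where open ≡-Reasoning

  *-nonzero : ∀ x y → x ≢ 0ℚ → y ≢ 0ℚ → x * y ≢ 0ℚ
  *-nonzero x y x≢0 y≢0 xy≡0 = y≢0 (zero-product x y x≢0 xy≡0)

  inv-unique : ∀ x y → x ≢ 0ℚ → x * y ≡ 1ℚ → inv x ≡ y
  inv-unique x y x≢0 xy≡1 = begin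
    inv x            ≡⟨ ℚ.*-identityʳ (inv x) ⟨
    inv x * 1ℚ       ≡⟨ cong (inv x *_) xy≡1 ⟨
    inv x * (x * y)  ≡⟨ ℚ.*-assoc (inv x) x y ⟨
    (inv x * x) * y  ≡⟨ cong (_* y) (inv-inverseˡ x x≢0) ⟩
    1ℚ * y           ≡⟨ ℚ.*-identityˡ y ⟩
    y                ∎
    where open ≡-Reasoning

  inv-* : ∀ x y → x ≢ 0ℚ → y ≢ 0ℚ → inv (x * y) ≡ inv x * inv y
  inv-* x y x≢0 y≢0 = inv-unique (x * y) (inv x * inv y) (*-nonzero x y x≢0 y≢0) (begin
    (x * y) * (inv x * inv y)  ≡⟨ regroup x y (inv x) (inv y) ⟩
    (x * inv x) * (y * inv y)  ≡⟨ cong₂ _*_ (inv-inverseʳ x x≢0) (inv-inverseʳ y y≢0) ⟩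
    1ℚ * 1ℚ                    ≡⟨⟩
    1ℚ                         ∎)
    where
    open ≡-Reasoning
    regroup : ∀ a b c d → (a * b) * (c * d) ≡ (a * c) * (b * d)
    regroup = solve-∀ ℚ-ring

  ^ℕ-+ : ∀ x m k → x ^ℕ (m ℕ.+ k) ≡ x ^ℕ m * x ^ℕ k
  ^ℕ-+ x zero k = sym (ℚ.*-identityˡ _)
  ^ℕ-+ x (suc m) k = trans (cong (x *_) (^ℕ-+ x m k)) (sym (ℚ.*-assoc x _ _))

  ^ℕ-* : ∀ x y k → (x * y) ^ℕ k ≡ x ^ℕ k * y ^ℕ k
  ^ℕ-* x y zero = refl
  ^ℕ-* x y (suc k) = trans (cong ((x * y) *_) (^ℕ-* x y k)) (regroup x y (x ^ℕ k) (y ^ℕ k))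
    where
    regroup : ∀ a b c d → (a * b) * (c * d) ≡ (a * c) * (b * d)
    regroup = solve-∀ ℚ-ring

  ^ℕ-nonzero : ∀ q k → q ≢ 0ℚ → q ^ℕ k ≢ 0ℚ
  ^ℕ-nonzero q zero q≢0 = 1≢0
  ^ℕ-nonzero q (suc k) q≢0 = *-nonzero q _ q≢0 (^ℕ-nonzero q k q≢0)

  ^ℤ-suc : ∀ q z → q ≢ 0ℚ → q ^ℤ (z ℤ.+ + 1) ≡ q ^ℤ z * q
  ^ℤ-suc q (+ m) q≢0 = trans (^ℕ-+ q m 1) (cong (q ^ℕ m *_) (ℚ.*-identityʳ q))
  ^ℤ-suc q -[1+ zero ] q≢0 = sym (trans (cong (λ z → inv z * q) (ℚ.*-identityʳ q)) (inv-inverseˡ q q≢0))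
  ^ℤ-suc q -[1+ suc m ] q≢0 = sym (begin
    inv (q * qᵐ⁺¹) * q          ≡⟨ cong (_* q) (inv-* q qᵐ⁺¹ q≢0 (^ℕ-nonzero q (suc m) q≢0)) ⟩
    (inv q * inv qᵐ⁺¹) * q      ≡⟨ regroup (inv q) (inv qᵐ⁺¹) q ⟩
    inv qᵐ⁺¹ * (inv q * q)      ≡⟨ cong (inv qᵐ⁺¹ *_) (inv-inverseˡ q q≢0) ⟩
    inv qᵐ⁺¹ * 1ℚ               ≡⟨ ℚ.*-identityʳ _ ⟩
    inv qᵐ⁺¹                    ∎)
    where
    open ≡-Reasoning
    qᵐ⁺¹ = q ^ℕ suc m
    regroup : ∀ a b c → (a * b) * c ≡ b * (a * c)
    regroup = solve-∀ ℚ-ring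

  ^ℤ-+ : ∀ q z k → q ≢ 0ℚ → q ^ℤ (z ℤ.+ + k) ≡ q ^ℤ z * q ^ℕ k
  ^ℤ-+ q z zero q≢0 = trans (cong (q ^ℤ_) (ℤ.+-identityʳ z)) (sym (ℚ.*-identityʳ _))
  ^ℤ-+ q z (suc k) q≢0 = begin
    q ^ℤ (z ℤ.+ + suc k)          ≡⟨ cong (q ^ℤ_) (ℤ.+-assoc z (+ 1) (+ k)) ⟨
    q ^ℤ ((z ℤ.+ + 1) ℤ.+ + k)    ≡⟨ ^ℤ-+ q (z ℤ.+ + 1) k q≢0 ⟩
    q ^ℤ (z ℤ.+ + 1) * q ^ℕ k     ≡⟨ cong (_* q ^ℕ k) (^ℤ-suc q z q≢0) ⟩
    (q ^ℤ z * q) * q ^ℕ k         ≡⟨ ℚ.*-assoc (q ^ℤ z) q (q ^ℕ k) ⟩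
    q ^ℤ z * q ^ℕ suc k           ∎
    where open ≡-Reasoning

  square≢1 : ∀ q → q ≢ 1ℚ → q ≢ -1ℚ → q * q ≢ 1ℚ
  square≢1 q q≢1 q≢-1 q²≡1 = q≢-1 (begin
    q                    ≡⟨ shift q ⟩
    (q + 1ℚ) + -1ℚ       ≡⟨ cong (_+ -1ℚ) q+1≡0 ⟩
    0ℚ + -1ℚ             ≡⟨⟩
    -1ℚ                  ∎)
    where
    open ≡-Reasoning
    shift : ∀ x → x ≡ (x + 1ℚ) + -1ℚ
    shift = solve-∀ ℚ-ring
    factor : ∀ x → (x + -1ℚ) * (x + 1ℚ) ≡ x * x + -1ℚ
    factor = solve-∀ ℚ-ring
    q-1≢0 : q + -1ℚ ≢ 0ℚ
    q-1≢0 q-1≡0 = q≢1 (trans (shift′ q) (cong (_+ 1ℚ) q-1≡0))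
      where
      shift′ : ∀ x → x ≡ (x + -1ℚ) + 1ℚ
      shift′ = solve-∀ ℚ-ring
    q+1≡0 : q + 1ℚ ≡ 0ℚ
    q+1≡0 = zero-product (q + -1ℚ) (q + 1ℚ) q-1≢0
              (trans (factor q) (cong (_+ -1ℚ) q²≡1))

  ^ℕ-above-1 : ∀ p k → 1ℚ < p → 1ℚ < p ^ℕ suc k
  ^ℕ-above-1 p zero 1<p = subst (1ℚ <_) (sym (ℚ.*-identityʳ p)) 1<p
  ^ℕ-above-1 p (suc k) 1<p = ℚ.<-trans 1<p (subst (_< p * p ^ℕ suc k) (ℚ.*-identityʳ p)
    (ℚ.*-monoʳ-<-pos p {{positive (ℚ.<-trans (ℚ.positive⁻¹ 1ℚ) 1<p)}} (^ℕ-above-1 p k 1<p)))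

  ^ℕ-below-1 : ∀ p k → Positive p → p < 1ℚ → p ^ℕ suc k < 1ℚ
  ^ℕ-below-1 p zero p>0 p<1 = subst (_< 1ℚ) (sym (ℚ.*-identityʳ p)) p<1
  ^ℕ-below-1 p (suc k) p>0 p<1 = ℚ.<-trans (subst (p * p ^ℕ suc k <_) (ℚ.*-identityʳ p)
    (ℚ.*-monoʳ-<-pos p {{p>0}} (^ℕ-below-1 p k p>0 p<1))) p<1

  positive-^ℕ≢1 : ∀ p k → Positive p → p ≢ 1ℚ → p ^ℕ suc k ≢ 1ℚ
  positive-^ℕ≢1 p k p>0 p≢1 with ℚ.<-cmp p 1ℚ
  ... | tri< p<1 _ _ = ℚ.<⇒≢ (^ℕ-below-1 p k p>0 p<1)
  ... | tri≈ _ p≡1 _ = ⊥-elim (p≢1 p≡1)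
  ... | tri> _ _ p>1 = λ pᵏ≡1 → ℚ.<⇒≢ (^ℕ-above-1 p k p>1) (sym pᵏ≡1)

  square-positive : ∀ q → q ≢ 0ℚ → Positive (q * q)
  square-positive q q≢0 with ℚ.<-cmp q 0ℚ
  ... | tri< q<0 _ _ = positive (subst (_< q * q) (ℚ.*-zeroˡ q)
                         (ℚ.*-monoˡ-<-neg q {{negative q<0}} q<0))
  ... | tri≈ _ q≡0 _ = ⊥-elim (q≢0 q≡0)
  ... | tri> _ _ q>0 = ℚ.pos*pos⇒pos q {{positive q>0}} q {{positive q>0}}

  -- For q ∉ {0, 1, -1} no nonzero power of q equals 1 (compare squares).
  ^ℕ≢1 : ∀ q k → q ≢ 0ℚ → q ≢ 1ℚ → q ≢ -1ℚ → q ^ℕ suc k ≢ 1ℚ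
  ^ℕ≢1 q k q≢0 q≢1 q≢-1 qᵏ≡1 =
    positive-^ℕ≢1 (q * q) k (square-positive q q≢0) (square≢1 q q≢1 q≢-1)
      (trans (^ℕ-* q q (suc k)) (cong₂ _*_ qᵏ≡1 qᵏ≡1))

  ^ℤ≢1 : ∀ q z → q ≢ 0ℚ → q ≢ 1ℚ → q ≢ -1ℚ → z ≢ 0ℤ → q ^ℤ z ≢ 1ℚ
  ^ℤ≢1 q (+ zero) _ _ _ z≢0 _ = z≢0 refl
  ^ℤ≢1 q (+ suc k) q≢0 q≢1 q≢-1 _ = ^ℕ≢1 q k q≢0 q≢1 q≢-1
  ^ℤ≢1 q -[1+ k ] q≢0 q≢1 q≢-1 _ inv≡1 = ^ℕ≢1 q k q≢0 q≢1 q≢-1 (begin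
    qᵏ⁺¹               ≡⟨ ℚ.*-identityʳ qᵏ⁺¹ ⟨
    qᵏ⁺¹ * 1ℚ          ≡⟨ cong (qᵏ⁺¹ *_) inv≡1 ⟨
    qᵏ⁺¹ * inv qᵏ⁺¹    ≡⟨ inv-inverseʳ qᵏ⁺¹ (^ℕ-nonzero q (suc k) q≢0) ⟩
    1ℚ                 ∎)
    where
    open ≡-Reasoning
    qᵏ⁺¹ = q ^ℕ suc k

  oneMinus-nonzero : ∀ q z → q ≢ 0ℚ → q ≢ 1ℚ → q ≢ -1ℚ → z ≢ 0ℤ → oneMinus q z ≢ 0ℚ
  oneMinus-nonzero q z q≢0 q≢1 q≢-1 z≢0 1-qᶻ≡0 = ^ℤ≢1 q z q≢0 q≢1 q≢-1 z≢0 (begin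
    q ^ℤ z                     ≡⟨ undo (q ^ℤ z) ⟩
    1ℚ + - (1ℚ + - (q ^ℤ z))   ≡⟨ cong (λ w → 1ℚ + - w) 1-qᶻ≡0 ⟩
    1ℚ + - 0ℚ                  ≡⟨⟩
    1ℚ                         ∎)
    where
    open ≡-Reasoning
    undo : ∀ x → x ≡ 1ℚ + - (1ℚ + - x)
    undo = solve-∀ ℚ-ring

  partial-fraction : ∀ x β A B → A * (1ℚ + - (x * β)) ≡ 1ℚ → B * (1ℚ + - x) ≡ 1ℚ →
                     (1ℚ + - β) * (A * B) ≡ B + - (β * A)
  partial-fraction x β A B A-inv B-inv = begin
    (1ℚ + - β) * (A * B)
      ≡⟨ expand x β A B ⟩
    B * (A * (1ℚ + - (x * β))) + - (β * A * (B * (1ℚ + - x)))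
      ≡⟨ cong₂ (λ u v → B * u + - (β * A * v)) A-inv B-inv ⟩
    B * 1ℚ + - (β * A * 1ℚ)
      ≡⟨ simplify β A B ⟩
    B + - (β * A) ∎
    where
    open ≡-Reasoning
    expand : ∀ x β A B → (1ℚ + - β) * (A * B) ≡ B * (A * (1ℚ + - (x * β))) + - (β * A * (B * (1ℚ + - x)))
    expand = solve-∀ ℚ-ring
    simplify : ∀ β A B → B * 1ℚ + - (β * A * 1ℚ) ≡ B + - (β * A)
    simplify = solve-∀ ℚ-ring

module ExponentIdentities {n : ℕ} (a : Fin n → ℕ) where

  open import Data.Bool using (Bool; true; false; if_then_else_; _∧_; not)
  import Data.Bool.Properties as Bool
  open import Data.Fin using (toℕ; _≟_)
  import Data.Fin.Properties as Fin
  open import Data.Fin.Subset using (Subset; inside; _-_)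
  open import Data.Fin.Subset.Properties using (_∈?_)
  import Data.Nat as ℕ
  import Data.Nat.Properties as ℕ
  import Data.Nat.Tactic.RingSolver as ℕ-Solver
  open import Data.Vec using (lookup)
  open import Data.Vec.Properties using (lookup∘update; lookup∘update′)
  open import Relation.Nullary using (Dec; yes; no; does)
  open import Relation.Nullary.Decidable using (dec-true; dec-false)

  open import Defs using (L; Ldel; aS; tailSum; _×?_; ¬?)
  open DecisionsAndSubsets
  module N = FiniteSums ℕ.+-0-isCommutativeMonoid

  _≤ᵇ_ _<ᵇ_ _≡ᵇ_ : Fin n → Fin n → Bool
  u ≤ᵇ v = does (toℕ u ℕ.≤? toℕ v)
  u <ᵇ v = does (toℕ u ℕ.<? toℕ v)
  u ≡ᵇ v = does (u ≟ v)

  Lrow : Subset n → Subset n → Fin n → ℕ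
  Lrow I K u = N.sum λ v → if (u ≤ᵇ v ∧ (lookup I u ∧ not (lookup K v))) then a v else 0

  Ldelrow : Fin n → Subset n → Subset n → Fin n → ℕ
  Ldelrow i I′ J u = N.sum λ v →
    if (u ≤ᵇ v ∧ ((not (u ≡ᵇ i) ∧ not (v ≡ᵇ i)) ∧ (lookup I′ u ∧ not (lookup J v)))) then a v else 0

  weight : Subset n → ℕ
  weight K = N.sum λ v → if lookup K v then a v else 0

  weightAbove : Subset n → Fin n → ℕ
  weightAbove K i = N.sum λ v → if (i <ᵇ v ∧ lookup K v) then a v else 0

  L-rows : ∀ I K → L a I K ≡ N.sum (Lrow I K)
  L-rows I K = trans (N.fold-allFins n _) (N.sum-cong-≗ λ u → trans (N.fold-allFins n _)
    (N.sum-cong-≗ λ v → if-cong (a v) 0 (test u v)))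
    where
    test : ∀ u v → does ((toℕ u ℕ.≤? toℕ v) ×? ((u ∈? I) ×? ¬? (v ∈? K)))
                   ≡ (u ≤ᵇ v ∧ (lookup I u ∧ not (lookup K v)))
    test u v rewrite does-×? (toℕ u ℕ.≤? toℕ v) ((u ∈? I) ×? ¬? (v ∈? K))
                   | does-×? (u ∈? I) (¬? (v ∈? K)) | does-¬? (v ∈? K)
                   | does-∈? u I | does-∈? v K = refl

  Ldel-rows : ∀ i I′ J → Ldel a i I′ J ≡ N.sum (Ldelrow i I′ J)
  Ldel-rows i I′ J = trans (N.fold-allFins n _) (N.sum-cong-≗ λ u → trans (N.fold-allFins n _)
    (N.sum-cong-≗ λ v → if-cong (a v) 0 (test u v)))
    where
    test : ∀ u v → does ((toℕ u ℕ.≤? toℕ v) ×? ((¬? (u ≟ i) ×? ¬? (v ≟ i)) ×? ((u ∈? I′) ×? ¬? (v ∈? J))))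
                   ≡ (u ≤ᵇ v ∧ ((not (u ≡ᵇ i) ∧ not (v ≡ᵇ i)) ∧ (lookup I′ u ∧ not (lookup J v))))
    test u v rewrite does-×? (toℕ u ℕ.≤? toℕ v) ((¬? (u ≟ i) ×? ¬? (v ≟ i)) ×? ((u ∈? I′) ×? ¬? (v ∈? J)))
                   | does-×? (¬? (u ≟ i) ×? ¬? (v ≟ i)) ((u ∈? I′) ×? ¬? (v ∈? J))
                   | does-×? (¬? (u ≟ i)) (¬? (v ≟ i)) | does-×? (u ∈? I′) (¬? (v ∈? J))
                   | does-¬? (u ≟ i) | does-¬? (v ≟ i) | does-¬? (v ∈? J)
                   | does-∈? u I′ | does-∈? v J = refl

  aS-weight : ∀ K → aS a K ≡ weight K
  aS-weight K = trans (N.fold-allFins n _) (N.sum-cong-≗ λ v → if-cong (a v) 0 (does-∈? v K))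

  ≡ᵇ-refl : ∀ i → i ≡ᵇ i ≡ true
  ≡ᵇ-refl i = dec-true (i ≟ i) refl

  ≢⇒≡ᵇ-false : ∀ {u i} → u ≢ i → u ≡ᵇ i ≡ false
  ≢⇒≡ᵇ-false {u} {i} u≢i = dec-false (u ≟ i) u≢i

  ≢⇒≤ᵇ≡<ᵇ : ∀ {i v} → v ≢ i → i ≤ᵇ v ≡ i <ᵇ v
  ≢⇒≤ᵇ≡<ᵇ {i} {v} v≢i = compare (toℕ i ℕ.<? toℕ v)
    where
    compare : Dec (toℕ i ℕ.< toℕ v) → i ≤ᵇ v ≡ i <ᵇ v
    compare (yes i<v) = trans (dec-true (toℕ i ℕ.≤? toℕ v) (ℕ.<⇒≤ i<v))
                              (sym (dec-true (toℕ i ℕ.<? toℕ v) i<v))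
    compare (no i≮v) = trans (dec-false (toℕ i ℕ.≤? toℕ v)
                               λ i≤v → i≮v (ℕ.≤∧≢⇒< i≤v λ eq → v≢i (sym (Fin.toℕ-injective eq))))
                             (sym (dec-false (toℕ i ℕ.<? toℕ v) i≮v))

  tailSum-split : ∀ i I K → lookup I i ≡ true → lookup K i ≡ true →
                  tailSum a i ≡ Lrow I K i ℕ.+ weightAbove K i
  tailSum-split i I K i∈I i∈K =
    trans (N.fold-allFins n _) (trans (N.sum-cong-≗ split) (N.∑-distrib-+ rowᵢ above))
    where
    rowᵢ above : Fin n → ℕ
    rowᵢ v = if (i ≤ᵇ v ∧ (lookup I i ∧ not (lookup K v))) then a v else 0
    above v = if (i <ᵇ v ∧ lookup K v) then a v else 0
    split : ∀ v → (if i <ᵇ v then a v else 0) ≡ rowᵢ v ℕ.+ above v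
    split v with v ≟ i
    ... | yes refl rewrite i∈I | i∈K | Bool.∧-zeroʳ (v ≤ᵇ v)
                         | dec-false (toℕ v ℕ.<? toℕ v) (ℕ.<-irrefl refl) = refl
    ... | no v≢i rewrite i∈I | ≢⇒≤ᵇ≡<ᵇ {i} {v} v≢i with i <ᵇ v | lookup K v
    ...   | true  | true = refl
    ...   | true  | false = sym (ℕ.+-identityʳ _)
    ...   | false | _ = refl

  Ldel-delete : ∀ i I K → lookup K i ≡ true →
                Ldel a i (I - i) (K - i) ℕ.+ Lrow I K i ≡ L a I K
  Ldel-delete i I K i∈K = begin
    Ldel a i (I - i) (K - i) ℕ.+ Lrow I K i  ≡⟨ cong (ℕ._+ Lrow I K i) (Ldel-rows i (I - i) (K - i)) ⟩
    N.sum D ℕ.+ Lrow I K i                   ≡⟨ N.sum-exchange i D (Lrow I K) rows-agree ⟩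
    N.sum (Lrow I K) ℕ.+ D i                 ≡⟨ cong (N.sum (Lrow I K) ℕ.+_) row-i-vanishes ⟩
    N.sum (Lrow I K) ℕ.+ 0                   ≡⟨ ℕ.+-identityʳ _ ⟩
    N.sum (Lrow I K)                         ≡⟨ L-rows I K ⟨
    L a I K                                  ∎
    where
    open ≡-Reasoning
    D = Ldelrow i (I - i) (K - i)
    rows-agree : ∀ u → u ≢ i → D u ≡ Lrow I K u
    rows-agree u u≢i = N.sum-cong-≗ entry
      where
      entry : ∀ v → (if (u ≤ᵇ v ∧ ((not (u ≡ᵇ i) ∧ not (v ≡ᵇ i)) ∧ (lookup (I - i) u ∧ not (lookup (K - i) v)))) then a v else 0)
                    ≡ (if (u ≤ᵇ v ∧ (lookup I u ∧ not (lookup K v))) then a v else 0)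
      entry v with v ≟ i
      ... | yes refl rewrite ≢⇒≡ᵇ-false u≢i | i∈K
                           | Bool.∧-zeroʳ (lookup I u) | Bool.∧-zeroʳ (u ≤ᵇ v) = refl
      ... | no v≢i rewrite ≢⇒≡ᵇ-false u≢i
                         | lookup-delete-other I u≢i | lookup-delete-other K v≢i = refl
    row-i-vanishes : D i ≡ 0
    row-i-vanishes rewrite ≡ᵇ-refl i = trans (N.sum-cong-≗ λ v → if-cong (a v) 0 (Bool.∧-zeroʳ (i ≤ᵇ v))) (N.sum-replicate-zero n)

  exponent-reindex : ∀ i I K → lookup I i ≡ true → lookup K i ≡ true →
                     tailSum a i ℕ.+ Ldel a i (I - i) (K - i) ≡ L a I K ℕ.+ weightAbove K i
  exponent-reindex i I K i∈I i∈K = begin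
    tailSum a i ℕ.+ Ldel a i (I - i) (K - i)
      ≡⟨ cong (ℕ._+ Ldel a i (I - i) (K - i)) (tailSum-split i I K i∈I i∈K) ⟩
    (Lrow I K i ℕ.+ weightAbove K i) ℕ.+ Ldel a i (I - i) (K - i)
      ≡⟨ rearrange (Lrow I K i) (weightAbove K i) (Ldel a i (I - i) (K - i)) ⟩
    (Ldel a i (I - i) (K - i) ℕ.+ Lrow I K i) ℕ.+ weightAbove K i
      ≡⟨ cong (ℕ._+ weightAbove K i) (Ldel-delete i I K i∈K) ⟩
    L a I K ℕ.+ weightAbove K i ∎
    where
    open ≡-Reasoning
    rearrange : ∀ x y z → (x ℕ.+ y) ℕ.+ z ≡ (z ℕ.+ x) ℕ.+ y
    rearrange = ℕ-Solver.solve-∀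

  aS-insert : ∀ j J → lookup J j ≡ false → aS a (insert j J) ≡ a j ℕ.+ aS a J
  aS-insert j J j∉J = begin
    aS a (insert j J)          ≡⟨ aS-weight (insert j J) ⟩
    weight (insert j J)        ≡⟨ ℕ.+-identityʳ _ ⟨
    weight (insert j J) ℕ.+ 0  ≡⟨ cong (weight (insert j J) ℕ.+_) (if-cong (a j) 0 j∉J) ⟨
    weight (insert j J) ℕ.+ g j ≡⟨ N.sum-exchange j f g (λ v v≢j → if-cong (a v) 0 (lookup∘update′ v≢j J _)) ⟩
    weight J ℕ.+ f j           ≡⟨ cong (weight J ℕ.+_) (if-cong (a j) 0 (lookup∘update j J _)) ⟩
    weight J ℕ.+ a j           ≡⟨ ℕ.+-comm (weight J) (a j) ⟩
    a j ℕ.+ weight J           ≡⟨ cong (a j ℕ.+_) (aS-weight J) ⟨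
    a j ℕ.+ aS a J             ∎
    where
    open ≡-Reasoning
    f g : Fin n → ℕ
    f v = if lookup (insert j J) v then a v else 0
    g v = if lookup J v then a v else 0

  -- Adding to J the least element j₀ of I′ (j₀ ≠ i) removes from L_{I′,J}(a^{(i)}) exactly
  -- the pairs (u, j₀), and by minimality only u = j₀ contributes.
  Ldel-insert-minimum : ∀ i I′ j₀ J → lookup I′ j₀ ≡ true → j₀ ≢ i →
                        (∀ u → lookup I′ u ≡ true → toℕ j₀ ℕ.≤ toℕ u) → lookup J j₀ ≡ false →
                        Ldel a i I′ J ≡ Ldel a i I′ (insert j₀ J) ℕ.+ a j₀
  Ldel-insert-minimum i I′ j₀ J j₀∈I′ j₀≢i least j₀∉J = begin
    Ldel a i I′ J                                      ≡⟨ Ldel-rows i I′ J ⟩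
    N.sum (Ldelrow i I′ J)                             ≡⟨ N.sum-cong-≗ row-split ⟩
    N.sum (λ u → Ldelrow i I′ (insert j₀ J) u ℕ.+ h u) ≡⟨ N.∑-distrib-+ _ h ⟩
    N.sum (Ldelrow i I′ (insert j₀ J)) ℕ.+ N.sum h     ≡⟨ cong₂ ℕ._+_ (Ldel-rows i I′ (insert j₀ J))
                                                             (sym (trans (N.sum-single j₀ h h-off-j₀) h-at-j₀)) ⟨
    Ldel a i I′ (insert j₀ J) ℕ.+ a j₀                 ∎
    where
    open ≡-Reasoning
    entry : Subset n → Fin n → Fin n → ℕ
    entry J′ u v = if (u ≤ᵇ v ∧ ((not (u ≡ᵇ i) ∧ not (v ≡ᵇ i)) ∧ (lookup I′ u ∧ not (lookup J′ v)))) then a v else 0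
    -- the entry (u, j₀) lost by adding j₀ to J
    h : Fin n → ℕ
    h u = entry J u j₀
    h-off-j₀ : ∀ u → u ≢ j₀ → h u ≡ 0
    h-off-j₀ u u≢j₀ with lookup I′ u in u∈I′
    ... | false rewrite Bool.∧-zeroʳ (not (u ≡ᵇ i) ∧ not (j₀ ≡ᵇ i)) | Bool.∧-zeroʳ (u ≤ᵇ j₀) = refl
    ... | true rewrite dec-false (toℕ u ℕ.≤? toℕ j₀)
                         (λ u≤j₀ → u≢j₀ (Fin.toℕ-injective (ℕ.≤-antisym u≤j₀ (least u u∈I′)))) = refl
    h-at-j₀ : h j₀ ≡ a j₀
    h-at-j₀ rewrite dec-true (toℕ j₀ ℕ.≤? toℕ j₀) ℕ.≤-refl | ≢⇒≡ᵇ-false j₀≢i | j₀∈I′ | j₀∉J = refl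
    row-split : ∀ u → Ldelrow i I′ J u ≡ Ldelrow i I′ (insert j₀ J) u ℕ.+ h u
    row-split u = begin
      N.sum (entry J u)                             ≡⟨ ℕ.+-identityʳ _ ⟨
      N.sum (entry J u) ℕ.+ 0                       ≡⟨ cong (N.sum (entry J u) ℕ.+_) entry-j₀ ⟨
      N.sum (entry J u) ℕ.+ entry (insert j₀ J) u j₀ ≡⟨ N.sum-exchange j₀ _ _ agree ⟩
      N.sum (entry (insert j₀ J) u) ℕ.+ h u         ∎
      where
      agree : ∀ v → v ≢ j₀ → entry J u v ≡ entry (insert j₀ J) u v
      agree v v≢j₀ rewrite lookup∘update′ v≢j₀ J inside = refl
      entry-j₀ : entry (insert j₀ J) u j₀ ≡ 0
      entry-j₀ rewrite lookup∘update j₀ J inside | Bool.∧-zeroʳ (lookup I′ u)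
                     | Bool.∧-zeroʳ (not (u ≡ᵇ i) ∧ not (j₀ ≡ᵇ i)) | Bool.∧-zeroʳ (u ≤ᵇ j₀) = refl

-- Telescoping: Σ_{i ∈ K} q^{Σ_{j ∈ K, j > i} a_j} (1 - q^{a_i}) = 1 - q^{a_K}, since the
-- i-th summand is q^{Σ_{j ∈ K, j > i} a_j} - q^{Σ_{j ∈ K, j ≥ i} a_j}.
module Telescoping where

  open import Data.Bool using (Bool; true; false; if_then_else_)
  open import Data.Fin using () renaming (zero to fzero; suc to fsuc)
  open import Data.Fin.Subset using (Subset)
  open import Data.Integer using (+_)
  open import Data.Nat as ℕ using (zero; suc)
  open import Data.Rational using (ℚ; 0ℚ; 1ℚ; _+_; _*_; -_)
  import Data.Rational.Properties as ℚ
  open import Data.Vec using ([]; _∷_; lookup)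
  open import Tactic.RingSolver using (solve-∀)

  open import Defs using (_^ℕ_; oneMinus)
  open ExponentIdentities using (weight; weightAbove)
  open RationalArithmetic using (ℚ-ring; ^ℕ-+)
  module Q = FiniteSums ℚ.+-0-isCommutativeMonoid

  telescope : ∀ n (a : Fin n → ℕ) q (K : Subset n) →
              Q.sum (λ i → if lookup K i then q ^ℕ weightAbove a K i * oneMinus q (+ a i) else 0ℚ)
              ≡ oneMinus q (+ weight a K)
  telescope zero a q [] = refl
  telescope (suc n) a q (b ∷ K) =
    trans (cong (λ z → first b + z) (telescope n (a ∘ fsuc) q K)) (add-first b)
    where
    open import Function using (_∘_)
    rest = weight (a ∘ fsuc) K
    first : Bool → ℚ
    first b = if b then q ^ℕ rest * oneMinus q (+ a fzero) else 0ℚ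
    add-first : ∀ b → first b + oneMinus q (+ rest) ≡ oneMinus q (+ ((if b then a fzero else 0) ℕ.+ rest))
    add-first false = ℚ.+-identityˡ _
    add-first true = trans (collapse (q ^ℕ rest) (q ^ℕ a fzero))
                           (cong (λ z → 1ℚ + - z) (sym (^ℕ-+ q (a fzero) rest)))
      where
      collapse : ∀ x y → x * (1ℚ + - y) + (1ℚ + - x) ≡ 1ℚ + - (y * x)
      collapse = solve-∀ ℚ-ring

module SignReversal where

  open import Data.Bool using (true; false; if_then_else_)
  open import Data.Fin.Subset using (Subset)
  open import Data.Rational using (ℚ; 0ℚ; _+_; -_)
  import Data.Rational.Properties as ℚ
  open import Data.Vec using (lookup)

  open DecisionsAndSubsets using (insert)
  module Q = FiniteSums ℚ.+-0-isCommutativeMonoid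

  ΣS-neg : ∀ n (f : Subset n → ℚ) → Q.ΣS n (λ J → - f J) ≡ - Q.ΣS n f
  ΣS-neg n = Q.ΣS-hom n -_ refl ℚ.neg-distrib-+

  toggle-cancels : ∀ n (j : Fin n) (F : Subset n → ℚ) →
                   (∀ J → lookup J j ≡ false → F (insert j J) ≡ - F J) → Q.ΣS n F ≡ 0ℚ
  toggle-cancels n j F flip = begin
    Q.ΣS n F                                      ≡⟨ Q.ΣS-cong n split ⟩
    Q.ΣS n (λ J → with-j J + without-j J)         ≡⟨ Q.ΣS-⊕ n with-j without-j ⟩
    Q.ΣS n with-j + Q.ΣS n without-j              ≡⟨ cong (_+ Q.ΣS n without-j) (Q.ΣS-insert n j F) ⟩
    Q.ΣS n toggled + Q.ΣS n without-j             ≡⟨ Q.ΣS-⊕ n toggled without-j ⟨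
    Q.ΣS n (λ J → toggled J + without-j J)        ≡⟨ Q.ΣS-cong n cancel ⟩
    Q.ΣS n (λ _ → 0ℚ)                             ≡⟨ Q.ΣS-zero n ⟩
    0ℚ                                            ∎
    where
    open ≡-Reasoning
    with-j without-j toggled : Subset n → ℚ
    with-j J = if lookup J j then F J else 0ℚ
    without-j J = if lookup J j then 0ℚ else F J
    toggled J = if lookup J j then 0ℚ else F (insert j J)
    split : ∀ J → F J ≡ with-j J + without-j J
    split J with lookup J j
    ... | true = sym (ℚ.+-identityʳ _)
    ... | false = sym (ℚ.+-identityˡ _)
    cancel : ∀ J → toggled J + without-j J ≡ 0ℚ
    cancel J with lookup J j in j∉J
    ... | true = refl
    ... | false = trans (cong (_+ F J) (flip J j∉J)) (ℚ.+-inverseˡ (F J))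

module Identity {n : ℕ} (a : Fin n → ℕ) (I : Subset n) (r : ℤ) (q : ℚ) where

  open import Data.Bool using (Bool; true; false; if_then_else_)
  open import Data.Fin using (toℕ)
  open import Data.Fin.Subset using (_∈_; _⊆_; Nonempty; ∣_∣; _-_; ⊥)
  open import Data.Fin.Subset.Properties using (_⊆?_)
  open import Data.Integer as ℤ using (+_; 0ℤ)
  import Data.Integer.Tactic.RingSolver as ℤ-Solver
  import Data.Nat as ℕ
  import Data.Nat.Properties as ℕ
  import Data.Nat.Tactic.RingSolver as ℕ-Solver
  open import Data.Product using (_,_)
  open import Data.Rational using (0ℚ; 1ℚ; _+_; _*_; -_)
  import Data.Rational.Properties as ℚ
  open import Data.Vec using (lookup)
  open import Data.Vec.Properties using ([]=⇒lookup; lookup⇒[]=; lookup-replicate)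
  open import Relation.Nullary using (Dec; yes; no; does)
  open import Relation.Nullary.Decidable using (dec-false)
  open import Tactic.RingSolver using (solve-∀)
  open import Algebra.Bundles using (Ring)
  import Algebra.Properties.Semiring.Sum (Ring.semiring ℚ.+-*-ring) as ℚ-Sum

  open import Defs
  open DecisionsAndSubsets
  open RationalArithmetic
  open ExponentIdentities a
  open Telescoping using (telescope)
  open SignReversal using (ΣS-neg; toggle-cancels)
  module Q = FiniteSums ℚ.+-0-isCommutativeMonoid

  when : Bool → ℚ → ℚ
  when b x = if b then x else 0ℚ

  when-neg : ∀ b {x y} → x ≡ - y → when b x ≡ - when b y
  when-neg true x≡-y = x≡-y
  when-neg false _ = refl

  when-dec-cong : {P : Set} (d : Dec P) {x y : ℚ} → (P → x ≡ y) → when (does d) x ≡ when (does d) y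
  when-dec-cong (yes p) x≡y = x≡y p
  when-dec-cong (no _) _ = refl

  when-swap : ∀ b c x → when b (when c x) ≡ when c (when b x)
  when-swap true c x = refl
  when-swap false true x = refl
  when-swap false false x = refl

  sum-when : ∀ b (f : Fin n → ℚ) → Q.sum (λ i → when b (f i)) ≡ when b (Q.sum f)
  sum-when true f = refl
  sum-when false f = Q.sum-replicate-zero n

  e : Fin n → Subset n → ℕ
  e i J = tailSum a i ℕ.+ Ldel a i (I - i) J

  lhsTerm : Fin n → Subset n → ℚ
  lhsTerm i J = (-1ℚ ^ℕ (∣ J ∣ ℕ.+ 1)) * ((q ^ℕ e i J) *
    ((oneMinus q (+ a i) * oneMinus q (+ aS a J)) ÷' (oneMinus q (expA a r i) * oneMinus q (expB a r i J))))

  rhsTerm : Subset n → ℚ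
  rhsTerm J = (-1ℚ ^ℕ ∣ J ∣) * ((q ^ℕ L a I J) * (oneMinus q (+ aS a J) ÷' oneMinus q (expC a r J)))

  lhsInner : Fin n → ℚ
  lhsInner i = Q.ΣS n (λ J → when (does (nonemptySub? (I - i) J)) (lhsTerm i J))

  LHS-as-sum : LHS a I r q ≡ Q.sum (λ i → when (lookup I i) (lhsInner i))
  LHS-as-sum = trans (Q.fold-allFins n _) (Q.sum-cong-≗ λ i →
    cong₂ when (does-∈? i I) (Q.fold-allSubsets n _))

  RHS-as-sum : RHS a I r q ≡ Q.ΣS n (λ J → when (does (nonemptySub? I J)) (rhsTerm J))
  RHS-as-sum = Q.fold-allSubsets n _

  -- The partial fractions of lhsTerm i J: with A = B + a_J,
  --   (1 - q^{a_J}) / ((1 - q^A)(1 - q^B)) = 1/(1 - q^B) - q^{a_J}/(1 - q^A).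
  firstFraction secondFraction : Fin n → Subset n → ℚ
  firstFraction i J = (-1ℚ ^ℕ (∣ J ∣ ℕ.+ 1)) *
    ((q ^ℕ e i J) * (oneMinus q (+ a i) * inv (oneMinus q (expB a r i J))))
  secondFraction i J = (-1ℚ ^ℕ (∣ J ∣ ℕ.+ 1)) *
    ((q ^ℕ (e i J ℕ.+ aS a J)) * (oneMinus q (+ a i) * inv (oneMinus q (expA a r i))))

  -- firstFraction reindexed by K = J ∪ {i}, for K ⊆ I; 'cell i K' is the resulting
  -- contribution of the pair (i, K), nonzero only for i ∈ K.
  reindexedCore reindexed : Fin n → Subset n → ℚ
  reindexedCore i K =
    (-1ℚ ^ℕ ∣ K ∣) * ((q ^ℕ e i (K - i)) * (oneMinus q (+ a i) * inv (oneMinus q (expC a r K))))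
  reindexed i K = when (does (K ⊆? I)) (reindexedCore i K)

  cell : Fin n → Subset n → ℚ
  cell i K = when (lookup K i) (reindexed i K)

  expA≡expB+aS : ∀ i J → expA a r i ≡ expB a r i J ℤ.+ + aS a J
  expA≡expB+aS i J = regroup (+ total a) (+ a i) (+ aS a J) r
    where
    regroup : ∀ t x y r → (t ℤ.- x) ℤ.+ r ≡ (((t ℤ.- x) ℤ.- y) ℤ.+ r) ℤ.+ y
    regroup = ℤ-Solver.solve-∀

  expC-insert : ∀ i J → lookup J i ≡ false → expC a r (insert i J) ≡ expB a r i J
  expC-insert i J i∉J = begin
    (+ total a ℤ.- + aS a (insert i J)) ℤ.+ r  ≡⟨ cong (λ w → (+ total a ℤ.- + w) ℤ.+ r) (aS-insert i J i∉J) ⟩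
    (+ total a ℤ.- (+ a i ℤ.+ + aS a J)) ℤ.+ r ≡⟨ regroup (+ total a) (+ a i) (+ aS a J) r ⟩
    expB a r i J                               ∎
    where
    open ≡-Reasoning
    regroup : ∀ t x y r → (t ℤ.- (x ℤ.+ y)) ℤ.+ r ≡ ((t ℤ.- x) ℤ.- y) ℤ.+ r
    regroup = ℤ-Solver.solve-∀

  aS-∅ : aS a (⊥ {n}) ≡ 0
  aS-∅ = trans (aS-weight ⊥) (trans (N.sum-cong-≗ λ v → if-cong (a v) 0 (lookup-replicate v false)) (N.sum-replicate-zero n))

  ∅-fractions-agree : ∀ i → firstFraction i ⊥ ≡ secondFraction i ⊥
  ∅-fractions-agree i =
    cong₂ (λ k z → (-1ℚ ^ℕ (∣ ⊥ {n} ∣ ℕ.+ 1)) * ((q ^ℕ k) * (oneMinus q (+ a i) * inv (oneMinus q z))))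
          (sym (trans (cong (e i ⊥ ℕ.+_) aS-∅) (ℕ.+-identityʳ _)))
          (sym (trans (expA≡expB+aS i ⊥) (trans (cong (λ w → expB a r i ⊥ ℤ.+ + w) aS-∅) (ℤ.+-identityʳ (expB a r i ⊥)))))
    where import Data.Integer.Properties as ℤ

  -- Toggling the least element j₀ of I - i changes the sign of secondFraction i J but not
  -- the exponent e i J + a_J, by Ldel-insert-minimum and aS-insert.
  secondFraction-toggle : ∀ i j₀ J → lookup (I - i) j₀ ≡ true →
                          (∀ u → lookup (I - i) u ≡ true → toℕ j₀ ℕ.≤ toℕ u) → lookup J j₀ ≡ false →
                          secondFraction i (insert j₀ J) ≡ - secondFraction i J
  secondFraction-toggle i j₀ J j₀∈I-i least j₀∉J = begin
    secondFraction i (insert j₀ J)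
      ≡⟨ cong₂ (λ k E → (-1ℚ ^ℕ (k ℕ.+ 1)) * ((q ^ℕ E) * C)) (∣insert∣ J j₀ j₀∉J) exponent-invariant ⟩
    (-1ℚ * s) * ((q ^ℕ (e i J ℕ.+ aS a J)) * C)
      ≡⟨ negate s ((q ^ℕ (e i J ℕ.+ aS a J)) * C) ⟩
    - secondFraction i J ∎
    where
    open ≡-Reasoning
    C = oneMinus q (+ a i) * inv (oneMinus q (expA a r i))
    s = -1ℚ ^ℕ (∣ J ∣ ℕ.+ 1)
    negate : ∀ s y → (-1ℚ * s) * y ≡ - (s * y)
    negate = solve-∀ ℚ-ring
    j₀≢i : j₀ ≢ i
    j₀≢i refl = true≢false (trans (sym j₀∈I-i) (lookup-delete-same I i))
    exponent-invariant : e i (insert j₀ J) ℕ.+ aS a (insert j₀ J) ≡ e i J ℕ.+ aS a J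
    exponent-invariant = begin
      (tailSum a i ℕ.+ Ldel a i (I - i) (insert j₀ J)) ℕ.+ aS a (insert j₀ J)
        ≡⟨ cong ((tailSum a i ℕ.+ Ldel a i (I - i) (insert j₀ J)) ℕ.+_) (aS-insert j₀ J j₀∉J) ⟩
      (tailSum a i ℕ.+ Ldel a i (I - i) (insert j₀ J)) ℕ.+ (a j₀ ℕ.+ aS a J)
        ≡⟨ regroup (tailSum a i) (Ldel a i (I - i) (insert j₀ J)) (a j₀) (aS a J) ⟩
      (tailSum a i ℕ.+ (Ldel a i (I - i) (insert j₀ J) ℕ.+ a j₀)) ℕ.+ aS a J
        ≡⟨ cong (λ z → (tailSum a i ℕ.+ z) ℕ.+ aS a J)
                (Ldel-insert-minimum i (I - i) j₀ J j₀∈I-i j₀≢i least j₀∉J) ⟨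
      (tailSum a i ℕ.+ Ldel a i (I - i) J) ℕ.+ aS a J ∎
      where
      regroup : ∀ t l x y → (t ℕ.+ l) ℕ.+ (x ℕ.+ y) ≡ (t ℕ.+ (l ℕ.+ x)) ℕ.+ y
      regroup = ℕ-Solver.solve-∀

  -- When |I| ≥ 2, I - i has a least element, so the second fractions cancel in pairs.
  secondFraction-vanishes : ∀ i → 2 ℕ.≤ ∣ I ∣ →
                            Q.ΣS n (λ J → when (does (J ⊆? (I - i))) (secondFraction i J)) ≡ 0ℚ
  secondFraction-vanishes i 2≤∣I∣ with minimum (I - i) (delete-nonempty I i 2≤∣I∣)
  ... | j₀ , j₀∈I-i , least = toggle-cancels n j₀ F flip
    where
    F : Subset n → ℚ
    F J = when (does (J ⊆? (I - i))) (secondFraction i J)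
    j₀∈I-i′ = []=⇒lookup j₀∈I-i
    flip : ∀ J → lookup J j₀ ≡ false → F (insert j₀ J) ≡ - F J
    flip J j₀∉J = trans (if-cong _ 0ℚ (insert⊆⇔⊆ j₀ (I - i) J j₀∈I-i′))
      (when-neg (does (J ⊆? (I - i)))
        (secondFraction-toggle i j₀ J j₀∈I-i′ (λ u u∈ → least u (lookup⇒[]= u _ u∈)) j₀∉J))

  firstFraction-reindex : ∀ i → lookup I i ≡ true →
    Q.ΣS n (λ J → when (does (J ⊆? (I - i))) (firstFraction i J)) ≡ Q.ΣS n (cell i)
  firstFraction-reindex i i∈I = trans (Q.ΣS-cong n match) (sym (Q.ΣS-insert n i (reindexed i)))
    where
    reindexed≡first : ∀ J → lookup J i ≡ false → reindexedCore i (insert i J) ≡ firstFraction i J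
    reindexed≡first J i∉J =
      cong₃ (λ k K′ z → (-1ℚ ^ℕ k) * ((q ^ℕ e i K′) * (oneMinus q (+ a i) * inv (oneMinus q z))))
            (trans (∣insert∣ J i i∉J) (ℕ.+-comm 1 ∣ J ∣)) (insert-delete J i i∉J) (expC-insert i J i∉J)
      where
      cong₃ : ∀ {A B C D : Set} (f : A → B → C → D) {x x′ y y′ z z′} →
              x ≡ x′ → y ≡ y′ → z ≡ z′ → f x y z ≡ f x′ y′ z′
      cong₃ f refl refl refl = refl
    match : ∀ J → when (does (J ⊆? (I - i))) (firstFraction i J) ≡
                  (if lookup J i then 0ℚ else reindexed i (insert i J))
    match J with lookup J i in i∈J?
    ... | true = if-cong (firstFraction i J) 0ℚ (∈⇒⊈delete i I J i∈J?)
    ... | false = sym (trans (if-cong _ 0ℚ (insert⊆⇔⊆delete i I J i∈I i∈J?))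
                             (cong (when (does (J ⊆? (I - i)))) (reindexed≡first J i∈J?)))

  cells-outside-I : ∀ i → lookup I i ≡ false → Q.ΣS n (cell i) ≡ 0ℚ
  cells-outside-I i i∉I = trans (Q.ΣS-cong n vanish) (Q.ΣS-zero n)
    where
    vanish : ∀ K → cell i K ≡ 0ℚ
    vanish K with lookup K i in i∈K
    ... | false = refl
    ... | true = if-cong _ 0ℚ (dec-false (K ⊆? I)
                   λ K⊆I → true≢false (trans (sym ([]=⇒lookup (K⊆I (lookup⇒[]= i K i∈K)))) i∉I))

  -- For K ⊆ I, column K sums by telescoping: every cell carries the factor
  -- (-1)^{|K|} q^{L_{I,K}} / (1 - q^{C}), and the remaining factors
  -- q^{Σ_{j ∈ K, j > i} a_j} (1 - q^{a_i}) sum to 1 - q^{a_K}.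
  column-telescopes : ∀ K → K ⊆ I → Q.sum (λ i → when (lookup K i) (reindexedCore i K)) ≡ rhsTerm K
  column-telescopes K K⊆I = begin
    Q.sum (λ i → when (lookup K i) (reindexedCore i K)) ≡⟨ Q.sum-cong-≗ factor ⟩
    Q.sum (λ i → c * telescoped i)           ≡⟨ ℚ-Sum.*-distribˡ-sum c telescoped ⟨
    c * Q.sum telescoped                     ≡⟨ cong (c *_) (telescope n a q K) ⟩
    c * oneMinus q (+ weight K)              ≡⟨ cong (λ w → c * oneMinus q (+ w)) (aS-weight K) ⟨
    c * oneMinus q (+ aS a K)                ≡⟨ regroup s pL iC (oneMinus q (+ aS a K)) ⟩
    rhsTerm K                                ∎
    where
    open ≡-Reasoning
    s = -1ℚ ^ℕ ∣ K ∣
    pL = q ^ℕ L a I K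
    iC = inv (oneMinus q (expC a r K))
    c = (s * pL) * iC
    telescoped : Fin n → ℚ
    telescoped i = when (lookup K i) (q ^ℕ weightAbove K i * oneMinus q (+ a i))
    regroup : ∀ s pL iC o → ((s * pL) * iC) * o ≡ s * (pL * (o * iC))
    regroup = solve-∀ ℚ-ring
    pull-out : ∀ s pL pS o iC → s * ((pL * pS) * (o * iC)) ≡ ((s * pL) * iC) * (pS * o)
    pull-out = solve-∀ ℚ-ring
    factor : ∀ i → when (lookup K i) (reindexedCore i K) ≡ c * telescoped i
    factor i with lookup K i in i∈K
    ... | false = sym (ℚ.*-zeroʳ c)
    ... | true = begin
      s * ((q ^ℕ e i (K - i)) * (oneMinus q (+ a i) * iC))
        ≡⟨ cong (λ E → s * ((q ^ℕ E) * (oneMinus q (+ a i) * iC)))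
                (exponent-reindex i I K ([]=⇒lookup (K⊆I (lookup⇒[]= i K i∈K))) i∈K) ⟩
      s * ((q ^ℕ (L a I K ℕ.+ weightAbove K i)) * (oneMinus q (+ a i) * iC))
        ≡⟨ cong (λ z → s * (z * (oneMinus q (+ a i) * iC))) (^ℕ-+ q (L a I K) (weightAbove K i)) ⟩
      s * ((pL * q ^ℕ weightAbove K i) * (oneMinus q (+ a i) * iC))
        ≡⟨ pull-out s pL (q ^ℕ weightAbove K i) (oneMinus q (+ a i)) iC ⟩
      c * (q ^ℕ weightAbove K i * oneMinus q (+ a i)) ∎

  column-sum : ∀ K → Q.sum (λ i → cell i K) ≡ when (does (K ⊆? I)) (rhsTerm K)
  column-sum K = begin
    Q.sum (λ i → cell i K)                                     ≡⟨ Q.sum-cong-≗ (λ i → when-swap (lookup K i) (does (K ⊆? I)) (reindexedCore i K)) ⟩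
    Q.sum (λ i → when (does (K ⊆? I)) (core i))                ≡⟨ sum-when (does (K ⊆? I)) core ⟩
    when (does (K ⊆? I)) (Q.sum core)                          ≡⟨ when-dec-cong (K ⊆? I) (column-telescopes K) ⟩
    when (does (K ⊆? I)) (rhsTerm K)                           ∎
    where
    open ≡-Reasoning
    core : Fin n → ℚ
    core i = when (lookup K i) (reindexedCore i K)

  rhsTerm-∅ : rhsTerm ⊥ ≡ 0ℚ
  rhsTerm-∅ = trans (cong (λ w → (-1ℚ ^ℕ ∣ ⊥ {n} ∣) * ((q ^ℕ L a I ⊥) * (oneMinus q (+ w) * inv (oneMinus q (expC a r ⊥))))) aS-∅)
                    (vanish (-1ℚ ^ℕ ∣ ⊥ {n} ∣) (q ^ℕ L a I ⊥) (inv (oneMinus q (expC a r ⊥))))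
    where
    vanish : ∀ s p w → s * (p * ((1ℚ + - 1ℚ) * w)) ≡ 0ℚ
    vanish = solve-∀ ℚ-ring

  rhs-nonempty : Q.ΣS n (λ K → when (does (K ⊆? I)) (rhsTerm K)) ≡
                 Q.ΣS n (λ K → when (does (nonemptySub? I K)) (rhsTerm K))
  rhs-nonempty = begin
    Q.ΣS n all                   ≡⟨ Q.ΣS-adjoin-∅ n I rhsTerm ⟨
    Q.ΣS n nonempty + rhsTerm ⊥  ≡⟨ cong (λ z → Q.ΣS n nonempty + z) rhsTerm-∅ ⟩
    Q.ΣS n nonempty + 0ℚ         ≡⟨ ℚ.+-identityʳ _ ⟩
    Q.ΣS n nonempty              ∎
    where
    open ≡-Reasoning
    all nonempty : Subset n → ℚ
    all K = when (does (K ⊆? I)) (rhsTerm K)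
    nonempty K = when (does (nonemptySub? I K)) (rhsTerm K)

  module Assumptions (q≢0 : q ≢ 0ℚ) (q≢1 : q ≢ 1ℚ) (q≢-1 : q ≢ -1ℚ)
                     (expA≢0 : ∀ i → i ∈ I → expA a r i ≢ 0ℤ)
                     (expB≢0 : ∀ i J → i ∈ I → Nonempty J → J ⊆ (I - i) → expB a r i J ≢ 0ℤ) where

    lhsTerm-split : ∀ i J → i ∈ I → Nonempty J → J ⊆ (I - i) →
                    lhsTerm i J ≡ firstFraction i J + - secondFraction i J
    lhsTerm-split i J i∈I J≢∅ J⊆I-i = begin
      s * (qᵉ * ((oa * (1ℚ + - β)) * inv (1-qᴬ * 1-qᴮ)))
        ≡⟨ cong (λ z → s * (qᵉ * ((oa * (1ℚ + - β)) * z))) (inv-* 1-qᴬ 1-qᴮ 1-qᴬ≢0 1-qᴮ≢0) ⟩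
      s * (qᵉ * ((oa * (1ℚ + - β)) * (1/A * 1/B)))
        ≡⟨ cong (λ z → s * (qᵉ * z)) (ℚ.*-assoc oa (1ℚ + - β) (1/A * 1/B)) ⟩
      s * (qᵉ * (oa * ((1ℚ + - β) * (1/A * 1/B))))
        ≡⟨ cong (λ z → s * (qᵉ * (oa * z))) (partial-fraction qᴮ β 1/A 1/B 1/A-inverse 1/B-inverse) ⟩
      s * (qᵉ * (oa * (1/B + - (β * 1/A))))
        ≡⟨ distribute s qᵉ oa 1/B β 1/A ⟩
      s * (qᵉ * (oa * 1/B)) + - (s * ((qᵉ * β) * (oa * 1/A)))
        ≡⟨ cong (λ z → s * (qᵉ * (oa * 1/B)) + - (s * (z * (oa * 1/A)))) (^ℕ-+ q (e i J) (aS a J)) ⟨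
      firstFraction i J + - secondFraction i J ∎
      where
      open ≡-Reasoning
      s = -1ℚ ^ℕ (∣ J ∣ ℕ.+ 1)
      qᵉ = q ^ℕ e i J
      oa = oneMinus q (+ a i)
      β = q ^ℕ aS a J
      qᴮ = q ^ℤ expB a r i J
      1-qᴬ = oneMinus q (expA a r i)
      1-qᴮ = oneMinus q (expB a r i J)
      1-qᴬ≢0 = oneMinus-nonzero q _ q≢0 q≢1 q≢-1 (expA≢0 i i∈I)
      1-qᴮ≢0 = oneMinus-nonzero q _ q≢0 q≢1 q≢-1 (expB≢0 i J i∈I J≢∅ J⊆I-i)
      1/A = inv 1-qᴬ
      1/B = inv 1-qᴮ
      1-qᴬ≡ : 1-qᴬ ≡ 1ℚ + - (qᴮ * β)
      1-qᴬ≡ = cong (λ z → 1ℚ + - z) (trans (cong (q ^ℤ_) (expA≡expB+aS i J)) (^ℤ-+ q (expB a r i J) (aS a J) q≢0))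
      1/A-inverse : 1/A * (1ℚ + - (qᴮ * β)) ≡ 1ℚ
      1/A-inverse = trans (cong (1/A *_) (sym 1-qᴬ≡)) (inv-inverseˡ 1-qᴬ 1-qᴬ≢0)
      1/B-inverse : 1/B * (1ℚ + - qᴮ) ≡ 1ℚ
      1/B-inverse = inv-inverseˡ 1-qᴮ 1-qᴮ≢0
      distribute : ∀ s qᵉ oa 1/B β 1/A → s * (qᵉ * (oa * (1/B + - (β * 1/A)))) ≡
                   s * (qᵉ * (oa * 1/B)) + - (s * ((qᵉ * β) * (oa * 1/A)))
      distribute = solve-∀ ℚ-ring

    -- For i ∈ I the inner left-hand sum equals the sum of first fractions over all J ⊆ I - i:
    -- the second fractions sum to zero over all J ⊆ I - i, and the terms at J = ∅ agree.
    lhsInner-firstFractions : ∀ i → lookup I i ≡ true → 2 ℕ.≤ ∣ I ∣ →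
      lhsInner i ≡ Q.ΣS n (λ J → when (does (J ⊆? (I - i))) (firstFraction i J))
    lhsInner-firstFractions i i∈I 2≤∣I∣ = begin
      lhsInner i                            ≡⟨ Q.ΣS-cong n split ⟩
      Q.ΣS n (λ J → F J + - S J)            ≡⟨ Q.ΣS-⊕ n F (λ J → - S J) ⟩
      Q.ΣS n F + Q.ΣS n (λ J → - S J)       ≡⟨ cong (λ z → Q.ΣS n F + z) (ΣS-neg n S) ⟩
      Q.ΣS n F + - Q.ΣS n S                 ≡⟨ shift (Q.ΣS n F) (Q.ΣS n S) (secondFraction i ⊥) ⟩
      (Q.ΣS n F + secondFraction i ⊥) + - (Q.ΣS n S + secondFraction i ⊥)
        ≡⟨ cong₂ (λ u v → u + - v) adjoin-first adjoin-second ⟩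
      Q.ΣS n (λ J → when (does (J ⊆? (I - i))) (firstFraction i J)) + - 0ℚ
        ≡⟨ ℚ.+-identityʳ _ ⟩
      Q.ΣS n (λ J → when (does (J ⊆? (I - i))) (firstFraction i J)) ∎
      where
      open ≡-Reasoning
      F S : Subset n → ℚ
      F J = when (does (nonemptySub? (I - i) J)) (firstFraction i J)
      S J = when (does (nonemptySub? (I - i) J)) (secondFraction i J)
      split : ∀ J → when (does (nonemptySub? (I - i) J)) (lhsTerm i J) ≡ F J + - S J
      split J with nonemptySub? (I - i) J
      ... | yes (J≢∅ , J⊆I-i) = lhsTerm-split i J (lookup⇒[]= i I i∈I) J≢∅ J⊆I-i
      ... | no _ = refl
      shift : ∀ x y m → x + - y ≡ (x + m) + - (y + m)
      shift = solve-∀ ℚ-ring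
      adjoin-first = trans (cong (λ z → Q.ΣS n F + z) (sym (∅-fractions-agree i)))
                           (Q.ΣS-adjoin-∅ n (I - i) (firstFraction i))
      adjoin-second = trans (Q.ΣS-adjoin-∅ n (I - i) (secondFraction i)) (secondFraction-vanishes i 2≤∣I∣)

    row-sum : 2 ℕ.≤ ∣ I ∣ → ∀ i → when (lookup I i) (lhsInner i) ≡ Q.ΣS n (cell i)
    row-sum 2≤∣I∣ i with lookup I i in i∈I
    ... | true = trans (lhsInner-firstFractions i i∈I 2≤∣I∣) (firstFraction-reindex i i∈I)
    ... | false = sym (cells-outside-I i i∈I)


open import Defs
open import Data.Nat using (ℕ; _<_)
open import Data.Integer using (ℤ; 0ℤ)
open import Data.Fin using (Fin)
open import Data.Fin.Subset using (Subset; _∈_; _⊆_; _-_; ∣_∣; Nonempty)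
open import Data.Rational using (ℚ; 0ℚ; 1ℚ)
open import Relation.Binary.PropositionalEquality using (_≡_; _≢_)

proposition5p4 : (n : ℕ) (a : Fin n → ℕ) (I : Subset n) (r : ℤ) →
    (∀ i → 0 < a i) →
    2 Data.Nat.≤ ∣ I ∣ →
    (∀ i → i ∈ I → expA a r i ≢ 0ℤ) →
    (∀ i J → i ∈ I → Nonempty J → J ⊆ (I - i) → expB a r i J ≢ 0ℤ) →
    (∀ J → Nonempty J → J ⊆ I → expC a r J ≢ 0ℤ) →
    (q : ℚ) → q ≢ 0ℚ → q ≢ 1ℚ → q ≢ -1ℚ →
    LHS a I r q ≡ RHS a I r q
proposition5p4 n a I r _ 2≤∣I∣ expA≢0 expB≢0 _ q q≢0 q≢1 q≢-1 = begin
  LHS a I r q                                                ≡⟨ LHS-as-sum ⟩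
  Q.sum (λ i → when (lookup I i) (lhsInner i))               ≡⟨ Q.sum-cong-≗ (row-sum 2≤∣I∣) ⟩
  Q.sum (λ i → Q.ΣS n (cell i))                              ≡⟨ Q.sum-ΣS-comm n n cell ⟩
  Q.ΣS n (λ K → Q.sum (λ i → cell i K))                      ≡⟨ Q.ΣS-cong n column-sum ⟩
  Q.ΣS n (λ K → when (does (K ⊆? I)) (rhsTerm K))            ≡⟨ rhs-nonempty ⟩
  Q.ΣS n (λ K → when (does (nonemptySub? I K)) (rhsTerm K))  ≡⟨ RHS-as-sum ⟨
  RHS a I r q                                                ∎
  where
  open import Data.Fin.Subset.Properties using (_⊆?_)
  open import Data.Vec using (lookup)
  open import Relation.Nullary using (does)
  open Identity a I r q
  open Assumptions q≢0 q≢1 q≢-1 expA≢0 expB≢0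
  open ≡-Reasoning
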